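{- The function $\omega_0$ defined on all permutations (of finite sets of distinct positive integers) by $$\omega_0(\sigma)=u_1^{\mathrm{V}_0(\sigma)}u_2^{\mathrm{M}_0(\sigma)}u_3^{\mathrm{da}_0(\sigma)}u_4^{\mathrm{dd}_0(\sigma)}\alpha^{\mathrm{lma}(\sigma)}$$ is multiplicative.
   Context: For a permutation (word of distinct integers) $\sigma=\sigma_1\cdots\sigma_n$, with boundary conditions $\sigma_0=0$ and $\sigma_{n+1}=+\infty$, an index $i\in[n]$ is a peak if $\sigma_{i-1}<\sigma_i>\sigma_{i+1}$, a valley if $\sigma_{i-1}>\sigma_i<\sigma_{i+1}$, a double ascent if $\sigma_{i-1}<\sigma_i<\sigma_{i+1}$, a double descent if $\sigma_{i-1}>\sigma_i>\sigma_{i+1}$; $\mathrm{M}_0,\mathrm{V}_0,\mathrm{da}_0,\mathrm{dd}_0$ count these. $\mathrm{lma}(\sigma)$ is the number of left-to-right maxima. $u_1,\dots,u_4,\alpha$ are indeterminates. A permutation is basic if it begins with its greatest element. Every permutation $\sigma$ with $\mathrm{lma}(\sigma)=k$ has a unique basic decomposition $\sigma=\beta_1\beta_2\cdots\beta_k$ (concatenation) where each $\beta_i$ is basic and the first letter of each $\beta_i$ is a left-to-right maximum of $\sigma$. $\mathrm{red}(\sigma)$ is the permutation of $[n]$ obtained by replacing the $i$-th smallest letter of $\sigma$ by $i$. A function $\omega$ from permutations to a commutative algebra over $\mathbb{Q}$ is multiplicative if for all $\sigma$: (i) $\omega(\sigma)=\omega(\mathrm{red}(\sigma))$; (ii) if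 $\beta_1\cdots\beta_k$ is the basic decomposition of $\sigma$ then $\omega(\sigma)=\omega(\beta_1)\cdots\omega(\beta_k)$. -}

module Defs where

open import Level using (Level; _⊔_)
open import Data.Nat using (ℕ; zero; suc; _+_; _<_; _≤_; _<ᵇ_; _<?_)
open import Data.Bool using (Bool; true; false; if_then_else_)
open import Data.Maybe using (Maybe; just; nothing)
open import Data.List using (List; []; _∷_; _++_; map; filter; length; concat; foldr)
open import Data.List.Relation.Unary.All using (All)
open import Data.List.Relation.Unary.Unique.Propositional using (Unique)
open import Data.Product using (_×_)
open import Data.Unit using (⊤)
open import Data.Empty using (⊥)
open import Relation.Binary.PropositionalEquality using (_≡_)
open import Algebra.Bundles using (CommutativeRing)

IsPerm : List ℕ → Set
IsPerm σ = Unique σ × All (0 <_) σ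

-- Peaks, valleys, double ascents, double descents with σ₀ = 0, σ_{n+1} = +∞.
-- The right neighbour is a Maybe ℕ, with nothing standing for +∞.

data Kind : Set where
  peak valley dasc ddesc : Kind

ltNext : ℕ → Maybe ℕ → Bool
ltNext x nothing  = true
ltNext x (just y) = x <ᵇ y

classify : ℕ → ℕ → Maybe ℕ → Kind
classify p x nx with p <ᵇ x | ltNext x nx
... | true  | false = peak
... | false | true  = valley
... | true  | true  = dasc
... | false | false = ddesc

headM : List ℕ → Maybe ℕ
headM []      = nothing
headM (y ∷ _) = just y

kindsFrom : ℕ → List ℕ → List Kind
kindsFrom p []       = []
kindsFrom p (x ∷ xs) = classify p x (headM xs) ∷ kindsFrom x xs

kinds : List ℕ → List Kind
kinds σ = kindsFrom 0 σ

isKind : Kind → Kind → Bool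
isKind peak   peak   = true
isKind valley valley = true
isKind dasc   dasc   = true
isKind ddesc  ddesc  = true
isKind _      _      = false

countKind : Kind → List Kind → ℕ
countKind k []       = 0
countKind k (j ∷ js) = (if isKind k j then 1 else 0) + countKind k js

M₀ V₀ da₀ dd₀ : List ℕ → ℕ
M₀  σ = countKind peak   (kinds σ)
V₀  σ = countKind valley (kinds σ)
da₀ σ = countKind dasc   (kinds σ)
dd₀ σ = countKind ddesc  (kinds σ)

-- number of left-to-right maxima (letters are positive, so start at 0)
lmaFrom : ℕ → List ℕ → ℕ
lmaFrom m []       = 0
lmaFrom m (x ∷ xs) = if m <ᵇ x then suc (lmaFrom x xs) else lmaFrom m xs

lma : List ℕ → ℕ
lma σ = lmaFrom 0 σ

rank : List ℕ → ℕ → ℕ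
rank σ x = suc (length (filter (_<? x) σ))

red : List ℕ → List ℕ
red σ = map (rank σ) σ

data IsBasic : List ℕ → Set where
  basic : ∀ {x xs} → All (_≤ x) xs → IsBasic (x ∷ xs)

HeadIsLRMax : List ℕ → List ℕ → Set
HeadIsLRMax pre []      = ⊥
HeadIsLRMax pre (x ∷ _) = All (_< x) pre

HeadsAreLRMax : List ℕ → List (List ℕ) → Set
HeadsAreLRMax pre []       = ⊤
HeadsAreLRMax pre (b ∷ bs) = HeadIsLRMax pre b × HeadsAreLRMax (pre ++ b) bs

IsBasicDecomposition : List ℕ → List (List ℕ) → Set
IsBasicDecomposition σ bs =
  concat bs ≡ σ × All IsBasic bs × HeadsAreLRMax [] bs

module _ {c ℓ : Level} (R : CommutativeRing c ℓ) where
  open CommutativeRing R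

  pow : Carrier → ℕ → Carrier
  pow x zero    = 1#
  pow x (suc n) = x * pow x n

  prod : List Carrier → Carrier
  prod = foldr _*_ 1#

  Multiplicative : (List ℕ → Carrier) → Set ℓ
  Multiplicative ω =
    (∀ σ → IsPerm σ → ω σ ≈ ω (red σ)) ×
    (∀ σ bs → IsPerm σ → IsBasicDecomposition σ bs → ω σ ≈ prod (map ω bs))

  ω₀ : (u₁ u₂ u₃ u₄ α : Carrier) → List ℕ → Carrier
  ω₀ u₁ u₂ u₃ u₄ α σ =
    pow u₁ (V₀ σ) * pow u₂ (M₀ σ) * pow u₃ (da₀ σ) * pow u₄ (dd₀ σ) * pow α (lma σ)

-- ω₀ σ depends only on the word of kinds of σ (peak, valley, double ascent or
-- double descent at each position) and on lma σ.  Both are computed from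
-- comparisons between letters of σ and with the boundary 0, so they are unchanged
-- by the order-preserving map red.  In a basic decomposition every block begins
-- with a letter exceeding everything before it: the last letter of a block is
-- followed by a larger letter, just as by +∞, and the first letter of the next
-- block is preceded by a smaller one, just as by 0.  Hence the kinds of σ are the
-- concatenation of the kinds of the blocks, and the left-to-right maxima of σ are
-- the block heads, each contributing lma 1 to its block.  Since ω₀ turns
-- concatenation of kinds and addition of lma into products, ω₀ is multiplicative.
{-# OPTIONS --safe #-}
module Submission where

open import Defs
open import Algebra.Bundles using (CommutativeRing)
import Algebra.Properties.CommutativeSemigroup as CommutativeSemigroupProperties
open import Data.Bool using (true; false; if_then_else_)
open import Data.List using (List; []; _∷_; _++_; [_]; map; concat)
open import Data.Nat.ListAction using (sum)
open import Data.List.Properties using (++-identityʳ)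
open import Data.List.Membership.Propositional using (_∈_)
open import Data.List.Relation.Unary.All as All using (All; []; _∷_)
open import Data.List.Relation.Unary.All.Properties using (++⁻ʳ)
open import Data.List.Relation.Unary.Any using (here; there)
open import Data.List.Relation.Unary.Linked as Linked using (Linked; []; [-]; _∷_)
open import Data.Maybe using (just; nothing)
open import Data.Nat using (ℕ; zero; suc; _+_; _<_; _≤_; _<ᵇ_; _<?_; z≤n; s≤s)
open import Data.Nat.Properties
  using (≤-refl; <⇒≤; <ᵇ-reflects-<; ≤⇒≯; ≮⇒≥; <-irrefl; <-trans; <-≤-trans; ≤-<-trans;
         m≤n⇒m≤1+n; +-assoc)
open import Data.Product using (_,_)
open import Function using (_∘_)
open import Relation.Binary.PropositionalEquality
  using (_≡_; refl; sym; trans; cong; cong₂; module ≡-Reasoning)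
open import Relation.Nullary using (yes; no; contradiction)
open import Relation.Nullary.Decidable using (dec-true; dec-false)
open import Relation.Nullary.Reflects using (ofʸ; ofⁿ)

<⇒<ᵇ≡true : ∀ {m n} → m < n → (m <ᵇ n) ≡ true
<⇒<ᵇ≡true {m} {n} = dec-true (m <? n)

≥⇒<ᵇ≡false : ∀ {m n} → n ≤ m → (m <ᵇ n) ≡ false
≥⇒<ᵇ≡false {m} {n} n≤m = dec-false (m <? n) (≤⇒≯ n≤m)

classify-cong : ∀ p x nx q y ny → (p <ᵇ x) ≡ (q <ᵇ y) → ltNext x nx ≡ ltNext y ny →
                classify p x nx ≡ classify q y ny
classify-cong _ _ _ q y ny p≡q x≡y rewrite p≡q | x≡y with q <ᵇ y | ltNext y ny
... | true  | true  = refl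
... | true  | false = refl
... | false | true  = refl
... | false | false = refl

kindsFrom-cong-prev : ∀ {p q x} xs → (p <ᵇ x) ≡ (q <ᵇ x) →
                      kindsFrom p (x ∷ xs) ≡ kindsFrom q (x ∷ xs)
kindsFrom-cong-prev {p} {q} {x} xs p≡q =
  cong (_∷ kindsFrom x xs) (classify-cong p x (headM xs) q x (headM xs) p≡q refl)

module OrderPreserving {S : ℕ → Set} {f : ℕ → ℕ}
  (f-<ᵇ : ∀ {x y} → S x → S y → (f x <ᵇ f y) ≡ (x <ᵇ y)) where

  ltNext-map : ∀ {x} xs → S x → All S xs → ltNext (f x) (headM (map f xs)) ≡ ltNext x (headM xs)
  ltNext-map []       _  _        = refl
  ltNext-map (y ∷ ys) sx (sy ∷ _) = f-<ᵇ sx sy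

  kindsFrom-map : ∀ {p q} xs → All S xs → (∀ {x} → S x → (q <ᵇ f x) ≡ (p <ᵇ x)) →
                  kindsFrom q (map f xs) ≡ kindsFrom p xs
  kindsFrom-map         []       _          _   = refl
  kindsFrom-map {p} {q} (x ∷ xs) (sx ∷ sxs) q~p =
    cong₂ _∷_ (classify-cong q (f x) (headM (map f xs)) p x (headM xs) (q~p sx) (ltNext-map xs sx sxs))
              (kindsFrom-map xs sxs (f-<ᵇ sx))

  lmaFrom-map : ∀ {p q} xs → All S xs → (∀ {x} → S x → (q <ᵇ f x) ≡ (p <ᵇ x)) →
                lmaFrom q (map f xs) ≡ lmaFrom p xs
  lmaFrom-map         []       _          _   = refl
  lmaFrom-map {p} {q} (x ∷ xs) (sx ∷ sxs) q~p rewrite q~p sx with p <ᵇ x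
  ... | true  = cong suc (lmaFrom-map xs sxs (f-<ᵇ sx))
  ... | false = lmaFrom-map xs sxs q~p

rank-mono-≤ : ∀ σ {x y} → x ≤ y → rank σ x ≤ rank σ y
rank-mono-≤ []      _   = ≤-refl
rank-mono-≤ (z ∷ σ) {x} {y} x≤y
  with z <ᵇ x | <ᵇ-reflects-< z x | z <ᵇ y | <ᵇ-reflects-< z y
... | true  | _       | true  | _       = s≤s (rank-mono-≤ σ x≤y)
... | true  | ofʸ z<x | false | ofⁿ z≮y = contradiction (<-≤-trans z<x x≤y) z≮y
... | false | _       | true  | _       = m≤n⇒m≤1+n (rank-mono-≤ σ x≤y)
... | false | _       | false | _       = rank-mono-≤ σ x≤y

rank-mono-< : ∀ {σ x y} → x ∈ σ → x < y → rank σ x < rank σ y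
rank-mono-< {x ∷ σ} {x} {y} (here refl) x<y
  with x <ᵇ x | <ᵇ-reflects-< x x | x <ᵇ y | <ᵇ-reflects-< x y
... | true  | ofʸ x<x | _     | _       = contradiction x<x (<-irrefl refl)
... | false | _       | true  | _       = s≤s (rank-mono-≤ σ (<⇒≤ x<y))
... | false | _       | false | ofⁿ x≮y = contradiction x<y x≮y
rank-mono-< {z ∷ σ} {x} {y} (there x∈σ) x<y
  with z <ᵇ x | <ᵇ-reflects-< z x | z <ᵇ y | <ᵇ-reflects-< z y
... | true  | _       | true  | _       = s≤s (rank-mono-< x∈σ x<y)
... | true  | ofʸ z<x | false | ofⁿ z≮y = contradiction (<-trans z<x x<y) z≮y
... | false | _       | true  | _       = m≤n⇒m≤1+n (rank-mono-< x∈σ x<y)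
... | false | _       | false | _       = rank-mono-< x∈σ x<y

rank-<ᵇ : ∀ σ {x y} → x ∈ σ → (rank σ x <ᵇ rank σ y) ≡ (x <ᵇ y)
rank-<ᵇ σ {x} {y} x∈σ with x <? y
... | yes x<y = trans (<⇒<ᵇ≡true (rank-mono-< x∈σ x<y)) (sym (<⇒<ᵇ≡true x<y))
... | no  x≮y = trans (≥⇒<ᵇ≡false (rank-mono-≤ σ (≮⇒≥ x≮y))) (sym (≥⇒<ᵇ≡false (≮⇒≥ x≮y)))

module Reduction (σ : List ℕ) (σ>0 : All (0 <_) σ) where
  open OrderPreserving {S = _∈ σ} {rank σ} (λ x∈σ _ → rank-<ᵇ σ x∈σ)

  -- ranks are successors, so 0 <ᵇ rank σ x is true
  0-<ᵇ-rank : ∀ {x} → x ∈ σ → (0 <ᵇ rank σ x) ≡ (0 <ᵇ x)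
  0-<ᵇ-rank x∈σ = sym (<⇒<ᵇ≡true (All.lookup σ>0 x∈σ))

  kinds-red : kinds (red σ) ≡ kinds σ
  kinds-red = kindsFrom-map σ (All.tabulate (λ x∈σ → x∈σ)) 0-<ᵇ-rank

  lma-red : lma (red σ) ≡ lma σ
  lma-red = lmaFrom-map σ (All.tabulate (λ x∈σ → x∈σ)) 0-<ᵇ-rank

HeadIsLRMax-++⁻ʳ : ∀ pre {β} γ → HeadIsLRMax (pre ++ β) γ → HeadIsLRMax β γ
HeadIsLRMax-++⁻ʳ pre (y ∷ _) = ++⁻ʳ pre

HeadsAreLRMax⇒Linked : ∀ pre bs → HeadsAreLRMax pre bs → Linked HeadIsLRMax (pre ∷ bs)
HeadsAreLRMax⇒Linked pre []       _                = [-]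
HeadsAreLRMax⇒Linked pre (β ∷ bs) (β-head , heads) with HeadsAreLRMax⇒Linked (pre ++ β) bs heads
... | [-]          = β-head ∷ [-]
... | γ-head ∷ bs′ = β-head ∷ HeadIsLRMax-++⁻ʳ pre _ γ-head ∷ bs′

-- The block [ 0 ] stands for the boundary letter σ₀ = 0, which lies below every head.
decomposition-linked : ∀ {σ bs} → IsPerm σ → IsBasicDecomposition σ bs →
                       Linked HeadIsLRMax ([ 0 ] ∷ bs)
decomposition-linked {bs = []}          _             _                  = [-]
decomposition-linked {bs = [] ∷ _}      _             (_ , () ∷ _ , _)
decomposition-linked {bs = (x ∷ _) ∷ _} (_ , 0<x ∷ _) (refl , _ , heads) =
  (0<x ∷ []) ∷ Linked.tail (HeadsAreLRMax⇒Linked [] _ heads)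

kindsFrom-++ : ∀ {p q y} x xs ys → All (_< y) (x ∷ xs) → q < y →
               kindsFrom p (x ∷ xs ++ y ∷ ys) ≡ kindsFrom p (x ∷ xs) ++ kindsFrom q (y ∷ ys)
kindsFrom-++ {p} {y = y} x [] ys (x<y ∷ []) q<y =
  cong₂ _∷_ (classify-cong p x (just y) p x nothing refl (<⇒<ᵇ≡true x<y))
            (kindsFrom-cong-prev ys (trans (<⇒<ᵇ≡true x<y) (sym (<⇒<ᵇ≡true q<y))))
kindsFrom-++ {p} x (x′ ∷ xs) ys (_ ∷ xs<y) q<y =
  cong (classify p x (just x′) ∷_) (kindsFrom-++ x′ xs ys xs<y q<y)

kinds-concat : ∀ {bs} → Linked HeadIsLRMax bs → kinds (concat bs) ≡ concat (map kinds bs)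
kinds-concat {[]}                       []          = refl
kinds-concat {β ∷ []}                   [-]         =
  trans (cong kinds (++-identityʳ β)) (sym (++-identityʳ (kinds β)))
kinds-concat {[] ∷ _ ∷ _}               (_ ∷ bs)    = kinds-concat bs
kinds-concat {(x ∷ xs) ∷ (y ∷ ys) ∷ bs} (β<y ∷ bs′) = begin
  kinds (x ∷ xs ++ y ∷ ys ++ concat bs)
    ≡⟨ kindsFrom-++ x xs (ys ++ concat bs) β<y (≤-<-trans z≤n (All.head β<y)) ⟩
  kinds (x ∷ xs) ++ kinds (y ∷ ys ++ concat bs)
    ≡⟨ cong (kinds (x ∷ xs) ++_) (kinds-concat bs′) ⟩
  kinds (x ∷ xs) ++ concat (map kinds ((y ∷ ys) ∷ bs)) ∎
  where open ≡-Reasoning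

lmaFrom-above : ∀ {m x} xs → m < x → lmaFrom m (x ∷ xs) ≡ suc (lmaFrom x xs)
lmaFrom-above _ m<x rewrite <⇒<ᵇ≡true m<x = refl

lmaFrom-++-dominated : ∀ {m} xs ys → All (_≤ m) xs → lmaFrom m (xs ++ ys) ≡ lmaFrom m ys
lmaFrom-++-dominated []       _  []           = refl
lmaFrom-++-dominated (x ∷ xs) ys (x≤m ∷ xs≤m) rewrite ≥⇒<ᵇ≡false x≤m =
  lmaFrom-++-dominated xs ys xs≤m

lma-basic : ∀ {x xs} → All (_≤ x) xs → 0 < x → lma (x ∷ xs) ≡ 1
lma-basic {x} {xs} xs≤x 0<x = begin
  lma (x ∷ xs)                ≡⟨ lmaFrom-above xs 0<x ⟩
  suc (lmaFrom x xs)          ≡⟨ cong (suc ∘ lmaFrom x) (++-identityʳ xs) ⟨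
  suc (lmaFrom x (xs ++ []))  ≡⟨ cong suc (lmaFrom-++-dominated xs [] xs≤x) ⟩
  1                           ∎
  where open ≡-Reasoning

lmaFrom-concat : ∀ x xs bs → All IsBasic bs → Linked HeadIsLRMax ((x ∷ xs) ∷ bs) →
                 lmaFrom x (concat bs) ≡ sum (map lma bs)
lmaFrom-concat x xs []              _                     _                   = refl
lmaFrom-concat x xs ((y ∷ ys) ∷ bs) (basic ys≤y ∷ basics) ((x<y ∷ _) ∷ bs′) = begin
  lmaFrom x (y ∷ ys ++ concat bs)   ≡⟨ lmaFrom-above (ys ++ concat bs) x<y ⟩
  suc (lmaFrom y (ys ++ concat bs)) ≡⟨ cong suc (lmaFrom-++-dominated ys (concat bs) ys≤y) ⟩
  suc (lmaFrom y (concat bs))       ≡⟨ cong suc (lmaFrom-concat y ys bs basics bs′) ⟩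
  suc (sum (map lma bs))            ≡⟨ cong (_+ sum (map lma bs)) (lma-basic ys≤y 0<y) ⟨
  lma (y ∷ ys) + sum (map lma bs)   ∎
  where
  open ≡-Reasoning
  0<y : 0 < y
  0<y = ≤-<-trans z≤n x<y

countKind-++ : ∀ k ks ks′ → countKind k (ks ++ ks′) ≡ countKind k ks + countKind k ks′
countKind-++ k []       ks′ = refl
countKind-++ k (j ∷ ks) ks′ =
  trans (cong (n +_) (countKind-++ k ks ks′)) (sym (+-assoc n (countKind k ks) (countKind k ks′)))
  where n = if isKind k j then 1 else 0

module Weight {c ℓ} (R : CommutativeRing c ℓ) where
  open CommutativeRing R
    using (Carrier; _≈_; _*_; 1#; setoid; *-cong; *-congˡ; *-congʳ; *-identityˡ; *-identityʳ; *-assoc;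
           *-commutativeSemigroup)
    renaming (sym to ≈-sym; trans to ≈-trans; reflexive to ≈-reflexive)
  open CommutativeSemigroupProperties *-commutativeSemigroup using (interchange)
  open import Relation.Binary.Reasoning.Setoid setoid

  pow-+ : ∀ x m n → pow R x (m + n) ≈ pow R x m * pow R x n
  pow-+ x zero    n = ≈-sym (*-identityˡ _)
  pow-+ x (suc m) n = ≈-trans (*-congˡ (pow-+ x m n)) (≈-sym (*-assoc _ _ _))

  interchange⁵ : ∀ a b c d e a′ b′ c′ d′ e′ →
    (a * b * c * d * e) * (a′ * b′ * c′ * d′ * e′) ≈
    (a * a′) * (b * b′) * (c * c′) * (d * d′) * (e * e′)
  interchange⁵ a b c d e a′ b′ c′ d′ e′ = begin
    (a * b * c * d * e) * (a′ * b′ * c′ * d′ * e′)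
      ≈⟨ interchange _ _ _ _ ⟩
    (a * b * c * d) * (a′ * b′ * c′ * d′) * (e * e′)
      ≈⟨ *-congʳ (interchange _ _ _ _) ⟩
    (a * b * c) * (a′ * b′ * c′) * (d * d′) * (e * e′)
      ≈⟨ *-congʳ (*-congʳ (interchange _ _ _ _)) ⟩
    (a * b) * (a′ * b′) * (c * c′) * (d * d′) * (e * e′)
      ≈⟨ *-congʳ (*-congʳ (*-congʳ (interchange _ _ _ _))) ⟩
    (a * a′) * (b * b′) * (c * c′) * (d * d′) * (e * e′) ∎

  module _ (u₁ u₂ u₃ u₄ α : Carrier) where
    -- ω₀ σ is, by definition, monomial (kinds σ) (lma σ)
    monomial : List Kind → ℕ → Carrier
    monomial ks l = pow R u₁ (countKind valley ks) * pow R u₂ (countKind peak ks) *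
                    pow R u₃ (countKind dasc ks) * pow R u₄ (countKind ddesc ks) * pow R α l

    monomial-[] : monomial [] 0 ≈ 1#
    monomial-[] =
      ≈-trans (*-identityʳ _) (≈-trans (*-identityʳ _) (≈-trans (*-identityʳ _) (*-identityʳ _)))

    monomial-++ : ∀ ks ks′ l l′ → monomial ks l * monomial ks′ l′ ≈ monomial (ks ++ ks′) (l + l′)
    monomial-++ ks ks′ l l′ = ≈-trans (interchange⁵ _ _ _ _ _ _ _ _ _ _) (≈-sym
      (*-cong (*-cong (*-cong (*-cong (pow-count u₁ valley) (pow-count u₂ peak)) (pow-count u₃ dasc))
                      (pow-count u₄ ddesc))
              (pow-+ α l l′)))
      where
      pow-count : ∀ x k → pow R x (countKind k (ks ++ ks′)) ≈
                          pow R x (countKind k ks) * pow R x (countKind k ks′)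
      pow-count x k = ≈-trans (≈-reflexive (cong (pow R x) (countKind-++ k ks ks′)))
                              (pow-+ x (countKind k ks) (countKind k ks′))

    ω : List ℕ → Carrier
    ω = ω₀ R u₁ u₂ u₃ u₄ α

    prod-map-ω₀ : ∀ bs → prod R (map ω bs) ≈ monomial (concat (map kinds bs)) (sum (map lma bs))
    prod-map-ω₀ []       = ≈-sym monomial-[]
    prod-map-ω₀ (β ∷ bs) = begin
      ω β * prod R (map ω bs)
        ≈⟨ *-congˡ (prod-map-ω₀ bs) ⟩
      monomial (kinds β) (lma β) * monomial (concat (map kinds bs)) (sum (map lma bs))
        ≈⟨ monomial-++ (kinds β) _ (lma β) _ ⟩
      monomial (concat (map kinds (β ∷ bs))) (sum (map lma (β ∷ bs))) ∎

    ω₀-red : ∀ σ → IsPerm σ → ω σ ≈ ω (red σ)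
    ω₀-red σ (_ , σ>0) = ≈-reflexive (sym (cong₂ monomial kinds-red lma-red))
      where open Reduction σ σ>0

    ω₀-concat : ∀ σ bs → IsPerm σ → IsBasicDecomposition σ bs → ω σ ≈ prod R (map ω bs)
    ω₀-concat _ bs perm dec@(refl , basics , _) = begin
      ω (concat bs)
        ≡⟨ cong₂ monomial (kinds-concat (Linked.tail linked)) (lmaFrom-concat 0 [] bs basics linked) ⟩
      monomial (concat (map kinds bs)) (sum (map lma bs))
        ≈⟨ prod-map-ω₀ bs ⟨
      prod R (map ω bs) ∎
      where
      linked : Linked HeadIsLRMax ([ 0 ] ∷ bs)
      linked = decomposition-linked perm dec

lemma2p6 : ∀ {c ℓ} (R : CommutativeRing c ℓ)
             (u₁ u₂ u₃ u₄ α : CommutativeRing.Carrier R) →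
             Multiplicative R (ω₀ R u₁ u₂ u₃ u₄ α)
lemma2p6 R u₁ u₂ u₃ u₄ α = ω₀-red u₁ u₂ u₃ u₄ α , ω₀-concat u₁ u₂ u₃ u₄ α
  where open Weight R
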